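{- Let $q(n)$ denote the number of maximal independent sets of the ortho-hexagonal cactus $Q(n)$. Then $q(1)=5$, $q(2)=19$, $q(3)=72$, and $q(n)=3q(n-1)+3q(n-2)$ for all $n\ge 4$.
   Context: For $n\ge 1$, the ortho-hexagonal cactus $Q(n)$ is the graph formed by a chain of $n$ 6-cycles $B_1,\dots,B_n$, where for each $1\le i\le n-1$ the consecutive cycles $B_i$ and $B_{i+1}$ share exactly one vertex, non-consecutive cycles share no vertex, every vertex lies in at most two cycles, and for each $2\le i\le n-1$ the two shared (cut) vertices of $B_i$ are adjacent. An independent set is maximal if no further vertex can be added while keeping it independent. -}

module Defs where

open import Data.Nat using (ℕ; zero; suc; _+_; _*_; _∸_; _≡ᵇ_)
open import Data.Bool using (Bool; true; false; _∧_; _∨_; not; if_then_else_)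
open import Data.List using (List; []; _∷_; _++_; length; filterᵇ; map; concatMap; upTo)
open import Data.Bool.ListAction using (all)
open import Data.Product using (_×_; _,_)

-- Vertex set: {0, 1, ..., 5n}  (a chain of n hexagons sharing n-1 cut vertices
-- has 6n - (n-1) = 5n+1 vertices).
-- Hexagon B_{i+1} (i = 0, ..., n-1) consists of an "entry" vertex s i
-- together with the five new vertices 5i+1, ..., 5i+5, forming the 6-cycle
--   s i — 5i+1 — 5i+2 — 5i+3 — 5i+4 — 5i+5 — s i .
-- s 0 = 0 and, for i ≥ 1, s i = 5(i-1)+1, i.e. the vertex 5(i-1)+1 of the
-- previous hexagon is the cut vertex shared by B_i and B_{i+1}.
-- Hence in every middle hexagon the two cut vertices s i and 5i+1 are
-- adjacent (ortho position), consecutive hexagons share exactly one vertex,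
-- and non-consecutive hexagons are disjoint.

entry : ℕ → ℕ
entry zero    = 0
entry (suc i) = 5 * i + 1

hexEdges : ℕ → List (ℕ × ℕ)
hexEdges i =
  (entry i , 5 * i + 1) ∷ (5 * i + 1 , 5 * i + 2) ∷ (5 * i + 2 , 5 * i + 3) ∷
  (5 * i + 3 , 5 * i + 4) ∷ (5 * i + 4 , 5 * i + 5) ∷ (5 * i + 5 , entry i) ∷ []

edgesQ : ℕ → List (ℕ × ℕ)
edgesQ n = concatMap hexEdges (upTo n)

verticesQ : ℕ → ℕ
verticesQ n = 5 * n + 1

-- A vertex subset of {0,…,m-1} is a Boolean list of length m
-- (entry v is true iff v belongs to the set).
_∈?_ : ℕ → List Bool → Bool
_     ∈? []      = false
zero  ∈? (b ∷ _) = b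
suc v ∈? (_ ∷ S) = v ∈? S

insert : ℕ → List Bool → List Bool
insert _       []      = []
insert zero    (_ ∷ S) = true ∷ S
insert (suc v) (b ∷ S) = b ∷ insert v S

subsets : ℕ → List (List Bool)
subsets zero    = [] ∷ []
subsets (suc m) = map (true ∷_) (subsets m) ++ map (false ∷_) (subsets m)

independent : List (ℕ × ℕ) → List Bool → Bool
independent E S = all (λ { (u , v) → not (u ∈? S ∧ v ∈? S) }) E

maximalIndependent : ℕ → List (ℕ × ℕ) → List Bool → Bool
maximalIndependent m E S =
  independent E S ∧
  all (λ v → v ∈? S ∨ not (independent E (insert v S))) (upTo m)

q : ℕ → ℕ
q n = length (filterᵇ (maximalIndependent (verticesQ n) (edgesQ n))
                      (subsets (verticesQ n)))

-- Let c be the last cut vertex of Q(n), to which the next hexagon is glued.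
-- Call a vertex set S good if it is independent and every vertex other than c lies in S or
-- has a neighbour in S; a good S has c in S, or c dominated by S, or c free, and the maximal
-- independent sets are the good sets of the first two kinds. Gluing the hexagon on c adds
-- five new vertices, and whether S together with a set T of new vertices is good, and of which
-- kind, depends only on the kind of S and on T. So the numbers of good sets of the three kinds
-- evolve by one fixed 3 × 3 matrix, read off from the 32 choices of T; this matrix has
-- characteristic polynomial λ³ − 3λ² − 3λ, and the recurrence is Cayley–Hamilton.

module Submission where

open import Defs
open import Data.Bool using (Bool; true; false; _∧_; _∨_; not; T; if_then_else_)
open import Data.Bool.ListAction using (all; and)
open import Data.Bool.Properties using (∧-identityʳ; ∧-zeroʳ; ∨-zeroʳ)
open import Data.Empty using (⊥-elim)
open import Data.List using (List; []; _∷_; [_]; _++_; length; filterᵇ; map; concatMap; upTo)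
open import Data.List.Membership.Propositional using (_∈_)
open import Data.List.Membership.Propositional.Properties using (∈-upTo⁺)
open import Data.List.Properties
  using (map-cong; map-cong-local; upTo-∷ʳ; map-++; ++-assoc; ++-identityʳ; map-id; map-∘;
         concatMap-++; concatMap-cong; concatMap-map; map-concatMap)
open import Data.List.Relation.Unary.All as All using (All; []; _∷_)
open import Data.List.Relation.Unary.All.Properties using (applyUpTo⁺₁; ++⁺; map⁺)
open import Data.List.Relation.Unary.Any using (here; there)
open import Data.Nat using (ℕ; zero; suc; _+_; _*_; _∸_; _≤_; _<_; s≤s; z<s; s<s; _≡ᵇ_)
open import Data.Nat.GeneralisedArithmetic using (fold)
open import Data.Nat.ListAction using (sum)
open import Data.Nat.ListAction.Properties using (sum-++)
open import Data.Nat.Properties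
  using (≡ᵇ⇒≡; <⇒≢; <-≤-trans; m≤m+n; m<m+n; +-monoʳ-<; +-identityʳ; +-suc; +-assoc;
         +-commutativeSemigroup)
open import Data.Nat.Tactic.RingSolver using (solve-∀)
open import Algebra.Properties.CommutativeSemigroup +-commutativeSemigroup
  renaming (interchange to +-interchange)
open import Data.Product using (_×_; _,_)
open import Data.Unit using (tt)
open import Function using (_∘_)
open import Relation.Binary.PropositionalEquality
  using (_≡_; _≢_; refl; sym; trans; cong; cong₂; subst; subst₂; _≗_; module ≡-Reasoning)

≡ᵇ-refl : ∀ n → (n ≡ᵇ n) ≡ true
≡ᵇ-refl zero    = refl
≡ᵇ-refl (suc n) = ≡ᵇ-refl n

≢⇒≡ᵇ-false : ∀ {m n} → m ≢ n → (m ≡ᵇ n) ≡ false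
≢⇒≡ᵇ-false {m} {n} m≢n with m ≡ᵇ n in eq
... | false = refl
... | true  = ⊥-elim (m≢n (≡ᵇ⇒≡ m n (subst T (sym eq) tt)))

≡ᵇ-false⇒≢ : ∀ {m n} → (m ≡ᵇ n) ≡ false → m ≢ n
≡ᵇ-false⇒≢ {m} m≡ᵇn refl with () ← trans (sym (≡ᵇ-refl m)) m≡ᵇn

+-≡ᵇ-self : ∀ m j → (m + j ≡ᵇ m) ≡ (j ≡ᵇ 0)
+-≡ᵇ-self zero    j = refl
+-≡ᵇ-self (suc m) j = +-≡ᵇ-self m j

∨-not-∧ : ∀ a x y → a ∨ not (x ∧ y) ≡ (a ∨ not x) ∨ not y
∨-not-∧ true  x     y = refl
∨-not-∧ false true  y = refl
∨-not-∧ false false y = refl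

∈?-++ˡ : ∀ {v} (S T : List Bool) → v < length S → v ∈? (S ++ T) ≡ v ∈? S
∈?-++ˡ {zero}  (b ∷ S) T _         = refl
∈?-++ˡ {suc v} (b ∷ S) T (s≤s v<m) = ∈?-++ˡ S T v<m

∈?-++ʳ : ∀ (S T : List Bool) j → (length S + j) ∈? (S ++ T) ≡ j ∈? T
∈?-++ʳ []      T j = refl
∈?-++ʳ (b ∷ S) T j = ∈?-++ʳ S T j

insert-++ˡ : ∀ {v} (S T : List Bool) → v < length S → insert v (S ++ T) ≡ insert v S ++ T
insert-++ˡ {zero}  (b ∷ S) T _         = refl
insert-++ˡ {suc v} (b ∷ S) T (s≤s v<m) = cong (b ∷_) (insert-++ˡ S T v<m)

insert-++ʳ : ∀ (S T : List Bool) j → insert (length S + j) (S ++ T) ≡ S ++ insert j T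
insert-++ʳ []      T j = refl
insert-++ʳ (b ∷ S) T j = cong (b ∷_) (insert-++ʳ S T j)

length-insert : ∀ v (S : List Bool) → length (insert v S) ≡ length S
length-insert v       []      = refl
length-insert zero    (b ∷ S) = refl
length-insert (suc v) (b ∷ S) = cong suc (length-insert v S)

∈?-insert-≢ : ∀ {u v} (S : List Bool) → u ≢ v → u ∈? insert v S ≡ u ∈? S
∈?-insert-≢                 []      u≢v = refl
∈?-insert-≢ {zero}  {zero}  (b ∷ S) u≢v = ⊥-elim (u≢v refl)
∈?-insert-≢ {zero}  {suc v} (b ∷ S) u≢v = refl
∈?-insert-≢ {suc u} {zero}  (b ∷ S) u≢v = refl
∈?-insert-≢ {suc u} {suc v} (b ∷ S) u≢v = ∈?-insert-≢ S (u≢v ∘ cong suc)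

∈?-insert-self : ∀ {v} (S : List Bool) → v < length S → v ∈? insert v S ≡ true
∈?-insert-self {zero}  (b ∷ S) _         = refl
∈?-insert-self {suc v} (b ∷ S) (s≤s v<m) = ∈?-insert-self S v<m

all-++ : ∀ {A : Set} (p : A → Bool) xs ys → all p (xs ++ ys) ≡ all p xs ∧ all p ys
all-++ p []       ys = refl
all-++ p (x ∷ xs) ys rewrite all-++ p xs ys with p x
... | true  = refl
... | false = refl

all-cong : ∀ {A : Set} {f g : A → Bool} → f ≗ g → all f ≗ all g
all-cong f≗g = cong and ∘ map-cong f≗g

all-cong-local : ∀ {A : Set} {f g : A → Bool} {xs} → All (λ x → f x ≡ g x) xs → all f xs ≡ all g xs
all-cong-local = cong and ∘ map-cong-local

all-cong-upTo : ∀ {f g : ℕ → Bool} m → (∀ {v} → v < m → f v ≡ g v) → all f (upTo m) ≡ all g (upTo m)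
all-cong-upTo m f≡g = all-cong-local (applyUpTo⁺₁ _ m f≡g)

all-∨ʳ : ∀ {A : Set} (f : A → Bool) b xs → all (λ x → f x ∨ b) xs ≡ all f xs ∨ b
all-∨ʳ f b []       = refl
all-∨ʳ f b (x ∷ xs) rewrite all-∨ʳ f b xs with f x | b
... | true  | _     = refl
... | false | true  = ∨-zeroʳ (all f xs)
... | false | false = refl

all-false : ∀ {A : Set} {f : A → Bool} {c xs} → c ∈ xs → f c ≡ false → all f xs ≡ false
all-false (here refl) fc rewrite fc = refl
all-false {f = f} {xs = x ∷ xs} (there c∈xs) fc = trans (cong (f x ∧_) (all-false c∈xs fc)) (∧-zeroʳ (f x))

all-extract : ∀ (f : ℕ → Bool) {c : ℕ} {xs : List ℕ} → c ∈ xs →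
  all f xs ≡ all (λ v → (v ≡ᵇ c) ∨ f v) xs ∧ f c
all-extract f {c} {xs} c∈xs with f c in fc
... | true  = trans (all-cong absorb xs) (sym (∧-identityʳ _))
  where
  absorb : ∀ v → f v ≡ ((v ≡ᵇ c) ∨ f v)
  absorb v with v ≡ᵇ c in v≡ᵇc
  ... | false = refl
  ... | true  rewrite ≡ᵇ⇒≡ v c (subst T (sym v≡ᵇc) tt) = fc
... | false = trans (all-false c∈xs fc) (sym (∧-zeroʳ _))

count : ∀ {A : Set} → (A → Bool) → List A → ℕ
count p xs = sum (map (λ x → if p x then 1 else 0) xs)

length-filterᵇ : ∀ {A : Set} (p : A → Bool) xs → length (filterᵇ p xs) ≡ count p xs
length-filterᵇ p []       = refl
length-filterᵇ p (x ∷ xs) with p x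
... | true  = cong suc (length-filterᵇ p xs)
... | false = length-filterᵇ p xs

count-cong : ∀ {A : Set} {p q : A → Bool} → p ≗ q → count p ≗ count q
count-cong p≗q = cong sum ∘ map-cong (λ x → cong (λ b → if b then 1 else 0) (p≗q x))

count-map : ∀ {A B : Set} (p : B → Bool) (f : A → B) xs → count p (map f xs) ≡ count (p ∘ f) xs
count-map p f xs = cong sum (sym (map-∘ xs))

count-concatMap : ∀ {A B : Set} (p : B → Bool) (f : A → List B) xs →
  count p (concatMap f xs) ≡ sum (map (count p ∘ f) xs)
count-concatMap p f []       = refl
count-concatMap p f (x ∷ xs) = begin
  count p (f x ++ concatMap f xs)             ≡⟨ cong sum (map-++ _ (f x) (concatMap f xs)) ⟩
  sum (map _ (f x) ++ map _ (concatMap f xs)) ≡⟨ sum-++ (map _ (f x)) _ ⟩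
  count p (f x) + count p (concatMap f xs)    ≡⟨ cong (count p (f x) +_) (count-concatMap p f xs) ⟩
  count p (f x) + sum (map (count p ∘ f) xs)  ∎
  where open ≡-Reasoning

sum-map-+ : ∀ {A : Set} (f g : A → ℕ) xs → sum (map (λ x → f x + g x) xs) ≡ sum (map f xs) + sum (map g xs)
sum-map-+ f g []       = refl
sum-map-+ f g (x ∷ xs) = trans (cong (f x + g x +_) (sum-map-+ f g xs)) (+-interchange (f x) (g x) _ _)

upTo-+ : ∀ a b → upTo (a + b) ≡ upTo a ++ map (a +_) (upTo b)
upTo-+ a zero    = trans (cong upTo (+-identityʳ a)) (sym (++-identityʳ (upTo a)))
upTo-+ a (suc b) = begin
  upTo (a + suc b)                              ≡⟨ cong upTo (+-suc a b) ⟩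
  upTo (suc (a + b))                            ≡⟨ upTo-∷ʳ (a + b) ⟨
  upTo (a + b) ++ [ a + b ]                     ≡⟨ cong (_++ [ a + b ]) (upTo-+ a b) ⟩
  (upTo a ++ map (a +_) (upTo b)) ++ [ a + b ]  ≡⟨ ++-assoc (upTo a) _ _ ⟩
  upTo a ++ (map (a +_) (upTo b) ++ [ a + b ])  ≡⟨ cong (upTo a ++_) (map-++ (a +_) (upTo b) [ b ]) ⟨
  upTo a ++ map (a +_) (upTo b ++ [ b ])        ≡⟨ cong (λ bs → upTo a ++ map (a +_) bs) (upTo-∷ʳ b) ⟩
  upTo a ++ map (a +_) (upTo (suc b))           ∎
  where open ≡-Reasoning

subsets-length : ∀ m → All (λ S → length S ≡ m) (subsets m)
subsets-length zero    = refl ∷ []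
subsets-length (suc m) = ++⁺ (map⁺ extended) (map⁺ extended)
  where
  extended : All (λ S → suc (length S) ≡ suc m) (subsets m)
  extended = All.map (cong suc) (subsets-length m)

subsets-+ : ∀ a b → subsets (a + b) ≡ concatMap (λ S → map (S ++_) (subsets b)) (subsets a)
subsets-+ zero    b = sym (trans (++-identityʳ _) (map-id (subsets b)))
subsets-+ (suc a) b = begin
  map (true ∷_) (subsets (a + b)) ++ map (false ∷_) (subsets (a + b))
    ≡⟨ cong₂ _++_ (prepend true) (prepend false) ⟩
  concatMap f (map (true ∷_) (subsets a)) ++ concatMap f (map (false ∷_) (subsets a))
    ≡⟨ concatMap-++ f (map (true ∷_) (subsets a)) _ ⟨
  concatMap f (subsets (suc a)) ∎
  where
  open ≡-Reasoning
  f : List Bool → List (List Bool)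
  f S = map (S ++_) (subsets b)
  prepend : ∀ x → map (x ∷_) (subsets (a + b)) ≡ concatMap f (map (x ∷_) (subsets a))
  prepend x = begin
    map (x ∷_) (subsets (a + b))           ≡⟨ cong (map (x ∷_)) (subsets-+ a b) ⟩
    map (x ∷_) (concatMap f (subsets a))   ≡⟨ map-concatMap (x ∷_) f (subsets a) ⟩
    concatMap (map (x ∷_) ∘ f) (subsets a) ≡⟨ concatMap-cong (λ S → map-∘ (subsets b)) (subsets a) ⟨
    concatMap (f ∘ (x ∷_)) (subsets a)     ≡⟨ concatMap-map f (x ∷_) (subsets a) ⟨
    concatMap f (map (x ∷_) (subsets a))   ∎

EdgesWithin : ℕ → List (ℕ × ℕ) → Set
EdgesWithin m = All (λ (u , v) → u < m × v < m)

EdgesWithin-mono : ∀ {m m′ E} → m ≤ m′ → EdgesWithin m E → EdgesWithin m′ E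
EdgesWithin-mono m≤m′ = All.map (λ (u<m , v<m) → <-≤-trans u<m m≤m′ , <-≤-trans v<m m≤m′)

independent-++ : ∀ E F (S : List Bool) → independent (E ++ F) S ≡ independent E S ∧ independent F S
independent-++ E F S = all-++ _ E F

independent-cong : ∀ {m E} {X Y : List Bool} → EdgesWithin m E →
  (∀ {v} → v < m → v ∈? X ≡ v ∈? Y) → independent E X ≡ independent E Y
independent-cong []                   X≡Y = refl
independent-cong {X = X} {Y} ((u<m , v<m) ∷ E<m) X≡Y =
  cong₂ _∧_ (cong₂ (λ a b → not (a ∧ b)) (X≡Y u<m) (X≡Y v<m)) (independent-cong {X = X} {Y} E<m X≡Y)

independent-relabel : ∀ (ρ : ℕ → ℕ) E (X Y : List Bool) → (∀ v → v ∈? Y ≡ ρ v ∈? X) →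
  independent (map (λ (u , v) → ρ u , ρ v) E) X ≡ independent E Y
independent-relabel ρ []            X Y Y≡ρX = refl
independent-relabel ρ ((u , v) ∷ E) X Y Y≡ρX =
  cong₂ _∧_ (sym (cong₂ (λ a b → not (a ∧ b)) (Y≡ρX u) (Y≡ρX v))) (independent-relabel ρ E X Y Y≡ρX)

hexagon : ℕ → ℕ → List (ℕ × ℕ)
hexagon c m =
  (c , m) ∷ (m , m + 1) ∷ (m + 1 , m + 2) ∷ (m + 2 , m + 3) ∷ (m + 3 , m + 4) ∷ (m + 4 , c) ∷ []

hexagon-within : ∀ {c m} → c < m → EdgesWithin (m + 5) (hexagon c m)
hexagon-within {c} {m} c<m =
  (c<m+5 , m<m+5) ∷ (m<m+5 , new 1<5) ∷ (new 1<5 , new 2<5) ∷ (new 2<5 , new 3<5) ∷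
  (new 3<5 , new 4<5) ∷ (new 4<5 , c<m+5) ∷ []
  where
  c<m+5 = <-≤-trans c<m (m≤m+n m 5)
  m<m+5 = m<m+n m z<s
  new : ∀ {k} → k < 5 → m + k < m + 5
  new = +-monoʳ-< m
  1<5 : 1 < 5
  1<5 = s<s z<s
  2<5 : 2 < 5
  2<5 = s<s (s<s z<s)
  3<5 : 3 < 5
  3<5 = s<s (s<s (s<s z<s))
  4<5 : 4 < 5
  4<5 = s<s (s<s (s<s (s<s z<s)))

-- Vertex 0 stands for the old vertex c of the glued hexagon, 1, …, 5 for its new vertices.
hexagonIndependent : Bool → List Bool → Bool
hexagonIndependent b T = independent (hexagon 0 1) (b ∷ T)

independent-hexagon : ∀ c (S T : List Bool) →
  independent (hexagon c (length S)) (S ++ T) ≡ hexagonIndependent (c ∈? (S ++ T)) T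
independent-hexagon c S T = independent-relabel attach (hexagon 0 1) (S ++ T) ((c ∈? (S ++ T)) ∷ T) attach-∈?
  where
  attach : ℕ → ℕ
  attach zero          = c
  attach (suc zero)    = length S
  attach (suc (suc j)) = length S + suc j
  attach-∈? : ∀ v → v ∈? ((c ∈? (S ++ T)) ∷ T) ≡ attach v ∈? (S ++ T)
  attach-∈? zero          = refl
  attach-∈? (suc zero)    = trans (sym (∈?-++ʳ S T 0)) (cong (_∈? (S ++ T)) (+-identityʳ (length S)))
  attach-∈? (suc (suc j)) = sym (∈?-++ʳ S T (suc j))

independent-++-hexagon : ∀ {m E c} (S T : List Bool) → EdgesWithin m E → c < m → length S ≡ m →
  independent (E ++ hexagon c m) (S ++ T) ≡ independent E S ∧ hexagonIndependent (c ∈? S) T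
independent-++-hexagon {E = E} {c} S T E<m c<m refl =
  trans (independent-++ E (hexagon c (length S)) (S ++ T))
    (cong₂ _∧_ (independent-cong {X = S ++ T} {S} E<m (∈?-++ˡ S T))
               (trans (independent-hexagon c S T) (cong (λ b → hexagonIndependent b T) (∈?-++ˡ S T c<m))))

saturated : List (ℕ × ℕ) → List Bool → ℕ → Bool
saturated E S v = v ∈? S ∨ not (independent E (insert v S))

saturatedExcept : List (ℕ × ℕ) → ℕ → ℕ → List Bool → Bool
saturatedExcept E m c S = all (λ v → (v ≡ᵇ c) ∨ saturated E S v) (upTo m)

data State : Set where
  inSet dominated undominated bad : State

_==_ : State → State → Bool
inSet       == inSet       = true
dominated   == dominated   = true
undominated == undominated = true
bad         == bad         = true
_           == _           = false

classify : Bool → Bool → Bool → State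
classify false _     _     = bad
classify true  true  _     = inSet
classify true  false false = dominated
classify true  false true  = undominated

state : List (ℕ × ℕ) → ℕ → ℕ → List Bool → State
state E m c S = classify (independent E S ∧ saturatedExcept E m c S) (c ∈? S) (independent E (insert c S))

accepting : State → Bool
accepting inSet     = true
accepting dominated = true
accepting _         = false

accepting-classify : ∀ I R C A → I ∧ (R ∧ (C ∨ not A)) ≡ accepting (classify (I ∧ R) C A)
accepting-classify false R     C     A     = refl
accepting-classify true  false C     A     = refl
accepting-classify true  true  true  A     = refl
accepting-classify true  true  false false = refl
accepting-classify true  true  false true  = refl

maximalIndependent-state : ∀ {m c} E (S : List Bool) → c < m →
  maximalIndependent m E S ≡ accepting (state E m c S)
maximalIndependent-state {m} {c} E S c<m =
  trans (cong (independent E S ∧_) (all-extract (saturated E S) (∈-upTo⁺ c<m)))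
        (accepting-classify (independent E S) (saturatedExcept E m c S) (c ∈? S) (independent E (insert c S)))

newSaturated : Bool → Bool → List Bool → Bool
newSaturated I C T =
  all (λ j → (j ≡ᵇ 0) ∨ (j ∈? T ∨ not (I ∧ hexagonIndependent C (insert j T)))) (upTo 5)

-- The state of S ++ T in terms of T and the four bits (independent, saturated except at c,
-- c ∈ S, c can be added) from which state E m c S is formed.
gluedState : Bool → Bool → Bool → Bool → List Bool → State
gluedState I R C A T =
  classify ((I ∧ R) ∧ (hexagonIndependent C T ∧
                       ((C ∨ not (A ∧ hexagonIndependent true T)) ∧ newSaturated I C T)))
           (0 ∈? T) (I ∧ hexagonIndependent C (insert 0 T))

glue : State → List Bool → State
glue inSet       = gluedState true true true  true
glue dominated   = gluedState true true false false
glue undominated = gluedState true true false true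
glue bad         = λ _ → bad

gluedState-classify : ∀ I R C A T → gluedState I R C A T ≡ glue (classify (I ∧ R) C A) T
gluedState-classify false R     C     A     T = refl
gluedState-classify true  false C     A     T = refl
gluedState-classify true  true  true  A     T = refl
gluedState-classify true  true  false false T = refl
gluedState-classify true  true  false true  T = refl

∧-∨-not-rearrange : ∀ a r h y z → (a ∧ h) ∧ (((r ∨ not h) ∧ y) ∧ z) ≡ (a ∧ r) ∧ (h ∧ (y ∧ z))
∧-∨-not-rearrange false r     h     y z = refl
∧-∨-not-rearrange true  false true  y z = refl
∧-∨-not-rearrange true  false false y z = refl
∧-∨-not-rearrange true  true  true  y z = refl
∧-∨-not-rearrange true  true  false y z = refl

module Gluing (E : List (ℕ × ℕ)) (c : ℕ) (S T : List Bool)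
              (E<m : EdgesWithin (length S) E) (c<m : c < length S) where

  private
    m  = length S
    E⁺ = E ++ hexagon c m
    X  = S ++ T
    I  = independent E S
    R  = saturatedExcept E m c S
    C  = c ∈? S
    A  = independent E (insert c S)
    H  = hexagonIndependent

  saturated-old : ∀ {v} → v < m →
    saturated E⁺ X v ≡ v ∈? S ∨ not (independent E (insert v S) ∧ H (c ∈? insert v S) T)
  saturated-old {v} v<m = cong₂ (λ a b → a ∨ not b) (∈?-++ˡ S T v<m)
    (trans (cong (independent E⁺) (insert-++ˡ S T v<m))
           (independent-++-hexagon (insert v S) T E<m c<m (length-insert v S)))

  independent-insert-new : ∀ j → independent E⁺ (insert (m + j) X) ≡ I ∧ H C (insert j T)
  independent-insert-new j =
    trans (cong (independent E⁺) (insert-++ʳ S T j)) (independent-++-hexagon S (insert j T) E<m c<m refl)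

  saturated-new : ∀ j → saturated E⁺ X (m + j) ≡ j ∈? T ∨ not (I ∧ H C (insert j T))
  saturated-new j = cong₂ (λ a b → a ∨ not b) (∈?-++ʳ S T j) (independent-insert-new j)

  all-saturated-old : all (saturated E⁺ X) (upTo m) ≡ (R ∨ not (H C T)) ∧ (C ∨ not (A ∧ H true T))
  all-saturated-old = begin
    all (saturated E⁺ X) (upTo m)
      ≡⟨ all-extract _ (∈-upTo⁺ c<m) ⟩
    all (λ v → (v ≡ᵇ c) ∨ saturated E⁺ X v) (upTo m) ∧ saturated E⁺ X c
      ≡⟨ cong₂ _∧_ (all-cong-upTo m off-c) at-c ⟩
    all (λ v → ((v ≡ᵇ c) ∨ saturated E S v) ∨ not (H C T)) (upTo m) ∧ (C ∨ not (A ∧ H true T))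
      ≡⟨ cong (_∧ (C ∨ not (A ∧ H true T))) (all-∨ʳ _ _ (upTo m)) ⟩
    (R ∨ not (H C T)) ∧ (C ∨ not (A ∧ H true T)) ∎
    where
    open ≡-Reasoning
    at-c : saturated E⁺ X c ≡ C ∨ not (A ∧ H true T)
    at-c = trans (saturated-old c<m) (cong (λ b → C ∨ not (A ∧ H b T)) (∈?-insert-self S c<m))
    off-c : ∀ {v} → v < m →
      (v ≡ᵇ c) ∨ saturated E⁺ X v ≡ ((v ≡ᵇ c) ∨ saturated E S v) ∨ not (H C T)
    off-c {v} v<m with v ≡ᵇ c in v≡ᵇc
    ... | true  = refl
    ... | false = trans (saturated-old v<m)
      (trans (cong (λ b → v ∈? S ∨ not (independent E (insert v S) ∧ H b T))
                   (∈?-insert-≢ S (≡ᵇ-false⇒≢ v≡ᵇc ∘ sym)))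
             (∨-not-∧ (v ∈? S) (independent E (insert v S)) (H C T)))

  saturatedExcept-glue : saturatedExcept E⁺ (m + 5) m X ≡
    ((R ∨ not (H C T)) ∧ (C ∨ not (A ∧ H true T))) ∧ newSaturated I C T
  saturatedExcept-glue = begin
    all P (upTo (m + 5))                           ≡⟨ cong (all P) (upTo-+ m 5) ⟩
    all P (upTo m ++ map (m +_) (upTo 5))          ≡⟨ all-++ P (upTo m) (map (m +_) (upTo 5)) ⟩
    all P (upTo m) ∧ all P (map (m +_) (upTo 5))   ≡⟨ cong₂ _∧_ (trans (all-cong-upTo m old) all-saturated-old)
                                                                (all-cong {f = P ∘ (m +_)} new (upTo 5)) ⟩
    ((R ∨ not (H C T)) ∧ (C ∨ not (A ∧ H true T))) ∧ newSaturated I C T ∎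
    where
    open ≡-Reasoning
    P : ℕ → Bool
    P v = (v ≡ᵇ m) ∨ saturated E⁺ X v
    old : ∀ {v} → v < m → P v ≡ saturated E⁺ X v
    old {v} v<m = cong (_∨ saturated E⁺ X v) (≢⇒≡ᵇ-false (<⇒≢ v<m))
    new : ∀ j → P (m + j) ≡ (j ≡ᵇ 0) ∨ (j ∈? T ∨ not (I ∧ H C (insert j T)))
    new j = cong₂ _∨_ (+-≡ᵇ-self m j) (saturated-new j)

  state-glue : state E⁺ (m + 5) m X ≡ glue (state E m c S) T
  state-glue = begin
    state E⁺ (m + 5) m X
      ≡⟨ cong (λ k → classify (independent E⁺ X ∧ saturatedExcept E⁺ (m + 5) m X) (k ∈? X)
                              (independent E⁺ (insert k X))) (+-identityʳ m) ⟨
    classify (independent E⁺ X ∧ saturatedExcept E⁺ (m + 5) m X)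
             ((m + 0) ∈? X) (independent E⁺ (insert (m + 0) X))
      ≡⟨ classify-cong (trans (cong₂ _∧_ (independent-++-hexagon S T E<m c<m refl) saturatedExcept-glue)
                              (∧-∨-not-rearrange I R (H C T) _ _))
                       (∈?-++ʳ S T 0) (independent-insert-new 0) ⟩
    gluedState I R C A T
      ≡⟨ gluedState-classify I R C A T ⟩
    glue (state E m c S) T ∎
    where
    open ≡-Reasoning
    classify-cong : ∀ {a a′ b b′ d d′} → a ≡ a′ → b ≡ b′ → d ≡ d′ →
      classify a b d ≡ classify a′ b′ d′
    classify-cong refl refl refl = refl

state-++-hexagon : ∀ {m E c} (S T : List Bool) → EdgesWithin m E → c < m → length S ≡ m →
  state (E ++ hexagon c m) (m + 5) m (S ++ T) ≡ glue (state E m c S) T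
state-++-hexagon {E = E} {c} S T E<m c<m refl = Gluing.state-glue E c S T E<m c<m

states : List State
states = inSet ∷ dominated ∷ undominated ∷ bad ∷ []

Σ-State : (State → ℕ) → ℕ
Σ-State g = sum (map g states)

Σ-State-δ : ∀ (k : State → ℕ) s → Σ-State (λ s′ → if s == s′ then k s′ else 0) ≡ k s
Σ-State-δ k inSet       = +-identityʳ (k inSet)
Σ-State-δ k dominated   = +-identityʳ (k dominated)
Σ-State-δ k undominated = +-identityʳ (k undominated)
Σ-State-δ k bad         = +-identityʳ (k bad)

tally : ∀ {A : Set} → (A → State) → List A → State → ℕ
tally f xs s = count (λ x → f x == s) xs

sum-map-by-state : ∀ {A : Set} (k : State → ℕ) (f : A → State) xs →
  sum (map (k ∘ f) xs) ≡ Σ-State (λ s → tally f xs s * k s)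
sum-map-by-state k f []       = refl
sum-map-by-state k f (x ∷ xs) = begin
  k (f x) + sum (map (k ∘ f) xs)
    ≡⟨ cong₂ _+_ (sym (Σ-State-δ k (f x))) (sum-map-by-state k f xs) ⟩
  Σ-State (λ s → if f x == s then k s else 0) + Σ-State (λ s → tally f xs s * k s)
    ≡⟨ sum-map-+ (λ s → if f x == s then k s else 0) (λ s → tally f xs s * k s) states ⟨
  Σ-State (λ s → (if f x == s then k s else 0) + tally f xs s * k s)
    ≡⟨ cong sum (map-cong (λ s → indicator-* (f x == s) (tally f xs s) (k s)) states) ⟩
  Σ-State (λ s → tally f (x ∷ xs) s * k s) ∎
  where
  open ≡-Reasoning
  indicator-* : ∀ b n k → (if b then k else 0) + n * k ≡ ((if b then 1 else 0) + n) * k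
  indicator-* true  n k = refl
  indicator-* false n k = refl

transfer : State → State → ℕ
transfer s s′ = count (λ T → glue s T == s′) (subsets 5)

verticesQ-suc : ∀ n → verticesQ (suc n) ≡ verticesQ n + 5
verticesQ-suc = arithmetic
  where
  arithmetic : ∀ n → 5 * suc n + 1 ≡ 5 * n + 1 + 5
  arithmetic = solve-∀

entry<verticesQ : ∀ n → entry n < verticesQ n
entry<verticesQ zero    = z<s
entry<verticesQ (suc n) = subst (verticesQ n <_) (sym (verticesQ-suc n)) (m<m+n (verticesQ n) z<s)

hexEdges≡hexagon : ∀ n → hexEdges n ≡ hexagon (entry n) (verticesQ n)
hexEdges≡hexagon n
  rewrite +-assoc (5 * n) 1 1 | +-assoc (5 * n) 1 2 | +-assoc (5 * n) 1 3 | +-assoc (5 * n) 1 4 = refl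

edgesQ-suc : ∀ n → edgesQ (suc n) ≡ edgesQ n ++ hexagon (entry n) (verticesQ n)
edgesQ-suc n = begin
  concatMap hexEdges (upTo (suc n))            ≡⟨ cong (concatMap hexEdges) (upTo-∷ʳ n) ⟨
  concatMap hexEdges (upTo n ++ [ n ])         ≡⟨ concatMap-++ hexEdges (upTo n) [ n ] ⟩
  edgesQ n ++ (hexEdges n ++ [])               ≡⟨ cong (edgesQ n ++_) (++-identityʳ (hexEdges n)) ⟩
  edgesQ n ++ hexEdges n                       ≡⟨ cong (edgesQ n ++_) (hexEdges≡hexagon n) ⟩
  edgesQ n ++ hexagon (entry n) (verticesQ n)  ∎
  where open ≡-Reasoning

edgesQ-within : ∀ n → EdgesWithin (verticesQ n) (edgesQ n)
edgesQ-within zero    = []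
edgesQ-within (suc n) = subst₂ EdgesWithin (sym (verticesQ-suc n)) (sym (edgesQ-suc n))
  (++⁺ (EdgesWithin-mono (m≤m+n (verticesQ n) 5) (edgesQ-within n)) (hexagon-within (entry<verticesQ n)))

stateQ : ℕ → List Bool → State
stateQ n = state (edgesQ n) (verticesQ n) (entry n)

stateQ-suc : ∀ n (S T : List Bool) → length S ≡ verticesQ n → stateQ (suc n) (S ++ T) ≡ glue (stateQ n S) T
stateQ-suc n S T |S| = trans (cong₂ (λ E k → state E k (verticesQ n) (S ++ T)) (edgesQ-suc n) (verticesQ-suc n))
                             (state-++-hexagon S T (edgesQ-within n) (entry<verticesQ n) |S|)

N : ℕ → State → ℕ
N n = tally (stateQ n) (subsets (verticesQ n))

N-suc : ∀ n s′ → N (suc n) s′ ≡ Σ-State (λ s → N n s * transfer s s′)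
N-suc n s′ = begin
  count P (subsets (verticesQ (suc n)))
    ≡⟨ cong (count P ∘ subsets) (verticesQ-suc n) ⟩
  count P (subsets (m + 5))
    ≡⟨ cong (count P) (subsets-+ m 5) ⟩
  count P (concatMap (λ S → map (S ++_) (subsets 5)) (subsets m))
    ≡⟨ count-concatMap P (λ S → map (S ++_) (subsets 5)) (subsets m) ⟩
  sum (map (λ S → count P (map (S ++_) (subsets 5))) (subsets m))
    ≡⟨ cong sum (map-cong-local (All.map (λ {S} → glued {S}) (subsets-length m))) ⟩
  sum (map (λ S → transfer (stateQ n S) s′) (subsets m))
    ≡⟨ sum-map-by-state (λ s → transfer s s′) (stateQ n) (subsets m) ⟩
  Σ-State (λ s → N n s * transfer s s′) ∎
  where
  open ≡-Reasoning
  m = verticesQ n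
  P : List Bool → Bool
  P X = stateQ (suc n) X == s′
  glued : ∀ {S} → length S ≡ m → count P (map (S ++_) (subsets 5)) ≡ transfer (stateQ n S) s′
  glued {S} |S| = trans (count-map P (S ++_) (subsets 5))
                        (count-cong (λ T → cong (_== s′) (stateQ-suc n S T |S|)) (subsets 5))

counts : ℕ → ℕ × ℕ × ℕ
counts n = N n inSet , N n dominated , N n undominated

accepted : ℕ × ℕ × ℕ → ℕ
accepted (x , y , _) = x + y

step : ℕ × ℕ × ℕ → ℕ × ℕ × ℕ
step (x , y , z) = 2 * y + 2 * z , 2 * x + 2 * y + z , y + z

q≡accepted : ∀ n → q n ≡ accepted (counts n)
q≡accepted n = begin
  length (filterᵇ (maximalIndependent m (edgesQ n)) (subsets m))
    ≡⟨ length-filterᵇ _ (subsets m) ⟩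
  count (maximalIndependent m (edgesQ n)) (subsets m)
    ≡⟨ count-cong (λ S → maximalIndependent-state (edgesQ n) S (entry<verticesQ n)) (subsets m) ⟩
  count (accepting ∘ stateQ n) (subsets m)
    ≡⟨ sum-map-by-state (λ s → if accepting s then 1 else 0) (stateQ n) (subsets m) ⟩
  Σ-State (λ s → N n s * (if accepting s then 1 else 0))
    ≡⟨ weights (N n inSet) (N n dominated) (N n undominated) (N n bad) ⟩
  accepted (counts n) ∎
  where
  open ≡-Reasoning
  m = verticesQ n
  weights : ∀ x y z e → x * 1 + (y * 1 + (z * 0 + (e * 0 + 0))) ≡ x + y
  weights = solve-∀

counts-suc : ∀ n → counts (suc n) ≡ step (counts n)
counts-suc n =
  cong₂ _,_ (trans (N-suc n inSet) (row₁ x y z e))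
    (cong₂ _,_ (trans (N-suc n dominated) (row₂ x y z e)) (trans (N-suc n undominated) (row₃ x y z e)))
  where
  x = N n inSet
  y = N n dominated
  z = N n undominated
  e = N n bad
  -- The rows of the transfer matrix, obtained by evaluating transfer.
  row₁ : ∀ x y z e → x * 0 + (y * 2 + (z * 2 + (e * 0 + 0))) ≡ 2 * y + 2 * z
  row₁ = solve-∀
  row₂ : ∀ x y z e → x * 2 + (y * 2 + (z * 1 + (e * 0 + 0))) ≡ 2 * x + 2 * y + z
  row₂ = solve-∀
  row₃ : ∀ x y z e → x * 0 + (y * 1 + (z * 1 + (e * 0 + 0))) ≡ y + z
  row₃ = solve-∀

q≡accepted-fold : ∀ n → q n ≡ accepted (fold (counts 0) step n)
q≡accepted-fold n = trans (q≡accepted n) (cong accepted (counts≡fold n))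
  where
  counts≡fold : ∀ n → counts n ≡ fold (counts 0) step n
  counts≡fold zero    = refl
  counts≡fold (suc n) = trans (counts-suc n) (cong step (counts≡fold n))

accepted-step-cubic : ∀ v →
  accepted (step (step (step v))) ≡ 3 * accepted (step (step v)) + 3 * accepted (step v)
accepted-step-cubic (x , y , z) = polynomial x y z
  where
  polynomial : ∀ x y z →
    let x₁ = 2 * y + 2 * z ;    y₁ = 2 * x + 2 * y + z ;    z₁ = y + z
        x₂ = 2 * y₁ + 2 * z₁ ;  y₂ = 2 * x₁ + 2 * y₁ + z₁ ;  z₂ = y₁ + z₁
        x₃ = 2 * y₂ + 2 * z₂ ;  y₃ = 2 * x₂ + 2 * y₂ + z₂
    in x₃ + y₃ ≡ 3 * (x₂ + y₂) + 3 * (x₁ + y₁)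
  polynomial = solve-∀

theorem2p22 : (q 1 ≡ 5) × (q 2 ≡ 19) × (q 3 ≡ 72) ×
    ((n : ℕ) → 4 ≤ n → q n ≡ 3 * q (n ∸ 1) + 3 * q (n ∸ 2))
theorem2p22 = q≡accepted-fold 1 , q≡accepted-fold 2 , q≡accepted-fold 3 , recurrence
  where
  recurrence : (n : ℕ) → 4 ≤ n → q n ≡ 3 * q (n ∸ 1) + 3 * q (n ∸ 2)
  recurrence (suc (suc (suc n))) (s≤s (s≤s (s≤s _))) =
    trans (q≡accepted-fold (3 + n))
      (trans (accepted-step-cubic (fold (counts 0) step n))
             (sym (cong₂ (λ a b → 3 * a + 3 * b) (q≡accepted-fold (2 + n)) (q≡accepted-fold (1 + n)))))
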